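{- For every $n \ge 1$, the main cohort $\mathcal{M}_n$ contains exactly $\mathrm{Motz}_n = \sum_{k=0}^{\lfloor n/2\rfloor}\binom{n}{2k}\mathrm{Cat}_k$ arch systems (the $n$-th Motzkin number), where $\mathrm{Cat}_k=\binom{2k}{k}/(k+1)$.
   Context: An arch system of size $n$ is a set of $n$ non-crossing arches above a baseline connecting $2n$ points, each point an endpoint of exactly one arch; the empty system has size $0$. Concatenation $AB$ places $B$ right of $A$. An atom is a non-empty arch system that is not a concatenation of two non-empty ones; every atom is $\langle A\rangle$, obtained from its contents $A$ by adding one enclosing arch. The relation $\sim$ is the finest equivalence relation on arch systems such that for all arch systems $A,B,P,Q$ and all $a,b,c$ each an atom or empty: (R1) $A\sim B\Rightarrow\langle A\rangle\sim\langle B\rangle$; (R2) $a\sim b\Rightarrow PaQ\sim PbQ$; (R3) $PabQ\sim PbaQ$; (R4) $a\langle bc\rangle\sim\langle ab\rangle c$. Its equivalence classes are called cohorts. Let $N_n$ be the arch system of $n$ nested arches ($N_0$ empty, $N_n=\langle N_{n-1}\rangle$). The main cohort $\mathcal{M}_n$ is the cohort containing $N_n$. -}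

module Defs where

open import Data.Nat using (ℕ; zero; suc; _+_; _*_; _/_)
open import Data.Nat.Combinatorics using (_C_)
open import Data.List using (List; []; _∷_; _++_; map; upTo; length)
open import Data.Nat.ListAction using (sum)
open import Data.Maybe using (Maybe; just; nothing)
open import Data.List.Membership.Propositional using (_∈_)
open import Data.List.Relation.Unary.Unique.Propositional using (Unique)
open import Data.Product using (Σ; _×_)
open import Function.Bundles using (_⇔_)
open import Relation.Binary.PropositionalEquality using (_≡_)

-- An atom ⟨A⟩ is determined by its contents A; an arch system is a
-- (left-to-right) list of atoms (its unique decomposition into atoms).
data Atom : Set where
  ⟨_⟩ : List Atom → Atom

ArchSystem : Set
ArchSystem = List Atom

mutual
  sizeAtom : Atom → ℕ
  sizeAtom ⟨ A ⟩ = suc (size A)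

  size : ArchSystem → ℕ
  size [] = 0
  size (a ∷ A) = sizeAtom a + size A

AtomOrEmpty : Set
AtomOrEmpty = Maybe Atom

toAS : AtomOrEmpty → ArchSystem
toAS nothing = []
toAS (just a) = a ∷ []

enc : ArchSystem → ArchSystem
enc A = ⟨ A ⟩ ∷ []

-- The finest equivalence relation closed under (R1)-(R4):
-- inductively generated by reflexivity, symmetry, transitivity and the rules.
infix 4 _∼_
data _∼_ : ArchSystem → ArchSystem → Set where
  ∼-refl  : ∀ {A} → A ∼ A
  ∼-sym   : ∀ {A B} → A ∼ B → B ∼ A
  ∼-trans : ∀ {A B C} → A ∼ B → B ∼ C → A ∼ C
  R1 : ∀ {A B} → A ∼ B → enc A ∼ enc B
  R2 : ∀ (P Q : ArchSystem) {a b : AtomOrEmpty} →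
       toAS a ∼ toAS b → P ++ toAS a ++ Q ∼ P ++ toAS b ++ Q
  R3 : ∀ (P Q : ArchSystem) (a b : AtomOrEmpty) →
       P ++ toAS a ++ toAS b ++ Q ∼ P ++ toAS b ++ toAS a ++ Q
  R4 : ∀ (a b c : AtomOrEmpty) →
       toAS a ++ enc (toAS b ++ toAS c) ∼ enc (toAS a ++ toAS b) ++ toAS c

nested : ℕ → ArchSystem
nested zero = []
nested (suc n) = enc (nested n)

catalan : ℕ → ℕ
catalan k = ((2 * k) C k) / suc k

motzkin : ℕ → ℕ
motzkin n = sum (map (λ k → (n C (2 * k)) * catalan k) (upTo (suc (n / 2))))

HasCardinality : (ArchSystem → Set) → ℕ → Set
HasCardinality P m =
  Σ (List ArchSystem) λ L → Unique L × (∀ A → (A ∈ L) ⇔ P A) × (length L ≡ m)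

InMainCohort : ℕ → ArchSystem → Set
InMainCohort n A = A ∼ nested n

-- The rules R1–R4 preserve the size of an arch system and the property of being
-- unary-binary: every arch, and the baseline, carries at most two atoms, so that ⟨A⟩
-- is a unary-binary tree. Conversely R4 lets an atom ⟨N_p⟩ sink into a neighbouring
-- nest N_q, and this reduces every unary-binary system to N_n. So M_n consists of the
-- unary-binary systems of size n.
--
-- Such a system of size n is spelled by a unique word of n letters acting on a stack of
-- systems: wrap the top entry in an arch, push an empty entry, or join the two top
-- entries X, Y into ⟨X⟩⟨Y⟩ (a join and the push it consumes account for two arches).
-- For a system with k branchings (pairs ⟨X⟩⟨Y⟩) the k joins and the k pushes form a
-- ballot sequence, and the n − 2k wraps are placed freely among them.
-- This gives (n choose 2k) · Cat_k systems, the ballot sequences being counted by the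
-- reflection formula ballot b j = C(j + 2b, b) − C(j + 2b, b − 1).

module Submission where

open import Defs
open import Data.Nat using (ℕ; zero; suc; _+_; _*_; _/_; _≤_; z≤n; s≤s)
open import Data.Nat.Properties
  using (+-assoc; +-comm; +-suc; +-identityʳ; *-suc; *-comm; *-zeroʳ; *-identityʳ;
         *-distribˡ-+; *-distribʳ-+; +-cancelʳ-≡; +-mono-≤; ≤-trans; m≤m+n; m≤n+m;
         n≤1+n; ≤-reflexive; m+n∸m≡n; suc-injective; 0≢1+n; +-commutativeSemigroup; module ≤-Reasoning)
open import Data.Nat.Combinatorics using (_C_; nCk+nC[k+1]≡[n+1]C[k+1]; nCk≡nC[n∸k]; nC1≡n; k>n⇒nCk≡0)
open import Data.Nat.DivMod using (m*n/n≡m; /-monoˡ-≤)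
open import Data.Nat.Tactic.RingSolver using (solve-∀)
open import Data.List using (List; []; _∷_; _++_; map; length; concatMap; upTo)
open import Data.List.Properties using (length-++; length-map; map-cong)
open import Data.Nat.ListAction using (sum)
open import Data.List.Membership.Propositional using (_∈_)
open import Data.List.Membership.Propositional.Properties
  using (∈-map⁺; ∈-map⁻; ∈-++⁺ˡ; ∈-++⁺ʳ; ∈-++⁻; ∈-concat⁺′; ∈-concat⁻′; ∈-upTo⁺)
open import Data.List.Relation.Unary.All using (All; []; _∷_)
import Data.List.Relation.Unary.All as All
import Data.List.Relation.Unary.All.Properties as AllP
open import Data.List.Relation.Unary.Unique.Propositional using (Unique; []; _∷_)
import Data.List.Relation.Unary.Unique.Propositional.Properties as Unique
import Data.List.Relation.Unary.AllPairs as AllPairs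
import Data.List.Relation.Unary.AllPairs.Properties as AllPairsP
open import Data.List.Relation.Binary.Disjoint.Propositional using (Disjoint)
open import Data.Vec using (Vec; []; _∷_; head)
open import Data.Vec.Relation.Unary.All using ([]; _∷_) renaming (All to Allᵛ)
open import Data.Sum using (inj₁; inj₂)
open import Data.List.Relation.Unary.Any using (here)
open import Data.Maybe using (just; nothing)
open import Data.Product using (_×_; _,_; proj₁; proj₂)
open import Data.Unit using (⊤; tt)
open import Data.Empty using (⊥; ⊥-elim)
open import Function.Bundles using (_⇔_; mk⇔; Equivalence)
open import Function using (case_of_)
import Function.Properties.Equivalence as ⇔
open import Relation.Binary.PropositionalEquality
open import Algebra.Properties.CommutativeSemigroup +-commutativeSemigroup
  using (interchange; x∙yz≈y∙xz)

-- The main cohort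

mutual
  UnaryBinaryAtom : Atom → Set
  UnaryBinaryAtom ⟨ X ⟩ = UnaryBinary X

  UnaryBinary : ArchSystem → Set
  UnaryBinary []              = ⊤
  UnaryBinary (a ∷ [])        = UnaryBinaryAtom a
  UnaryBinary (a ∷ b ∷ [])    = UnaryBinaryAtom a × UnaryBinaryAtom b
  UnaryBinary (_ ∷ _ ∷ _ ∷ _) = ⊥

size-++ : ∀ A B → size (A ++ B) ≡ size A + size B
size-++ []      B = refl
size-++ (a ∷ A) B = trans (cong (sizeAtom a +_) (size-++ A B)) (sym (+-assoc (sizeAtom a) (size A) (size B)))

size-enc : ∀ A → size (enc A) ≡ suc (size A)
size-enc A = cong suc (+-identityʳ (size A))

size-nested : ∀ n → size (nested n) ≡ n
size-nested zero    = refl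
size-nested (suc n) = trans (size-enc (nested n)) (cong suc (size-nested n))

size-++ˡ : ∀ P {A B} → size A ≡ size B → size (P ++ A) ≡ size (P ++ B)
size-++ˡ []      e = e
size-++ˡ (p ∷ P) e = cong (sizeAtom p +_) (size-++ˡ P e)

size-++ʳ : ∀ Q {A B} → size A ≡ size B → size (A ++ Q) ≡ size (B ++ Q)
size-++ʳ Q {A} {B} e = trans (size-++ A Q) (trans (cong (_+ size Q) e) (sym (size-++ B Q)))

size-swap : ∀ A B Q → size (A ++ B ++ Q) ≡ size (B ++ A ++ Q)
size-swap A B Q = begin
  size (A ++ B ++ Q)          ≡⟨ size-++₃ A B ⟩
  size A + (size B + size Q)  ≡⟨ x∙yz≈y∙xz (size A) (size B) (size Q) ⟩
  size B + (size A + size Q)  ≡⟨ size-++₃ B A ⟨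
  size (B ++ A ++ Q)          ∎
  where
  open ≡-Reasoning
  size-++₃ : ∀ X Y → size (X ++ Y ++ Q) ≡ size X + (size Y + size Q)
  size-++₃ X Y = trans (size-++ X _) (cong (size X +_) (size-++ Y Q))

size-regroup : ∀ A B C → size (A ++ enc (B ++ C)) ≡ size (enc (A ++ B) ++ C)
size-regroup A B C = begin
  size (A ++ enc (B ++ C))         ≡⟨ size-++ A _ ⟩
  size A + size (enc (B ++ C))     ≡⟨ cong (size A +_) (trans (size-enc (B ++ C)) (cong suc (size-++ B C))) ⟩
  size A + suc (size B + size C)   ≡⟨ +-suc (size A) _ ⟩
  suc (size A + (size B + size C)) ≡⟨ cong suc (+-assoc (size A) _ _) ⟨
  suc (size A + size B + size C)   ≡⟨ cong (λ s → suc s + size C) (size-++ A B) ⟨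
  suc (size (A ++ B)) + size C     ≡⟨ cong (_+ size C) (size-enc (A ++ B)) ⟨
  size (enc (A ++ B)) + size C     ≡⟨ size-++ (enc (A ++ B)) C ⟨
  size (enc (A ++ B) ++ C)         ∎
  where open ≡-Reasoning

∼⇒size≡ : ∀ {A B} → A ∼ B → size A ≡ size B
∼⇒size≡ ∼-refl             = refl
∼⇒size≡ (∼-sym h)          = sym (∼⇒size≡ h)
∼⇒size≡ (∼-trans h h′)     = trans (∼⇒size≡ h) (∼⇒size≡ h′)
∼⇒size≡ (R1 {A} {B} h)     = trans (size-enc A) (trans (cong suc (∼⇒size≡ h)) (sym (size-enc B)))
∼⇒size≡ (R2 P Q {a} {b} h) = size-++ˡ P (size-++ʳ Q {toAS a} {toAS b} (∼⇒size≡ h))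
∼⇒size≡ (R3 P Q a b)       = size-++ˡ P (size-swap (toAS a) (toAS b) Q)
∼⇒size≡ (R4 a b c)         = size-regroup (toAS a) (toAS b) (toAS c)

replace-atom : ∀ P Q {x y} → (UnaryBinaryAtom x → UnaryBinaryAtom y) →
               UnaryBinary (P ++ x ∷ Q) → UnaryBinary (P ++ y ∷ Q)
replace-atom []              []          f u       = f u
replace-atom []              (_ ∷ [])    f (u , v) = f u , v
replace-atom (_ ∷ [])        []          f (u , v) = u , f v
replace-atom []              (_ ∷ _ ∷ _) f ()
replace-atom (_ ∷ [])        (_ ∷ _)     f ()
replace-atom (_ ∷ _ ∷ [])    Q           f ()
replace-atom (_ ∷ _ ∷ _ ∷ _) Q           f ()

swap-atoms : ∀ P Q x y → UnaryBinary (P ++ x ∷ y ∷ Q) → UnaryBinary (P ++ y ∷ x ∷ Q)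
swap-atoms []              []      x y (u , v) = v , u
swap-atoms []              (_ ∷ _) x y ()
swap-atoms (_ ∷ [])        Q       x y ()
swap-atoms (_ ∷ _ ∷ [])    Q       x y ()
swap-atoms (_ ∷ _ ∷ _ ∷ _) Q       x y ()

∼⇒UnaryBinary⇔ : ∀ {A B} → A ∼ B → UnaryBinary A ⇔ UnaryBinary B
∼⇒UnaryBinary⇔ ∼-refl                              = ⇔.refl
∼⇒UnaryBinary⇔ (∼-sym h)                           = ⇔.sym (∼⇒UnaryBinary⇔ h)
∼⇒UnaryBinary⇔ (∼-trans h h′)                      = ⇔.trans (∼⇒UnaryBinary⇔ h) (∼⇒UnaryBinary⇔ h′)
∼⇒UnaryBinary⇔ (R1 h)                              = ∼⇒UnaryBinary⇔ h
∼⇒UnaryBinary⇔ (R2 P Q {nothing} {nothing} h)      = ⇔.refl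
∼⇒UnaryBinary⇔ (R2 P Q {nothing} {just ⟨ _ ⟩} h)   = ⊥-elim (0≢1+n (∼⇒size≡ h))
∼⇒UnaryBinary⇔ (R2 P Q {just ⟨ _ ⟩} {nothing} h)   = ⊥-elim (0≢1+n (sym (∼⇒size≡ h)))
∼⇒UnaryBinary⇔ (R2 P Q {just _} {just _} h)        =
  mk⇔ (replace-atom P Q (Equivalence.to (∼⇒UnaryBinary⇔ h)))
      (replace-atom P Q (Equivalence.from (∼⇒UnaryBinary⇔ h)))
∼⇒UnaryBinary⇔ (R3 P Q nothing b)                  = ⇔.refl
∼⇒UnaryBinary⇔ (R3 P Q (just x) nothing)           = ⇔.refl
∼⇒UnaryBinary⇔ (R3 P Q (just x) (just y))          = mk⇔ (swap-atoms P Q x y) (swap-atoms P Q y x)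
∼⇒UnaryBinary⇔ (R4 nothing  nothing  nothing)  = ⇔.refl
∼⇒UnaryBinary⇔ (R4 nothing  nothing  (just _)) = mk⇔ (tt ,_) proj₂
∼⇒UnaryBinary⇔ (R4 nothing  (just _) nothing)  = ⇔.refl
∼⇒UnaryBinary⇔ (R4 nothing  (just _) (just _)) = ⇔.refl
∼⇒UnaryBinary⇔ (R4 (just _) nothing  nothing)  = mk⇔ proj₁ (_, tt)
∼⇒UnaryBinary⇔ (R4 (just _) nothing  (just _)) = ⇔.refl
∼⇒UnaryBinary⇔ (R4 (just _) (just _) nothing)  = ⇔.refl
∼⇒UnaryBinary⇔ (R4 (just _) (just _) (just _)) =
  mk⇔ (λ (u , v , w) → (u , v) , w) (λ ((u , v) , w) → u , v , w)

UnaryBinary-nested : ∀ n → UnaryBinary (nested n)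
UnaryBinary-nested zero    = tt
UnaryBinary-nested (suc n) = UnaryBinary-nested n

≡⇒∼ : ∀ {A B} → A ≡ B → A ∼ B
≡⇒∼ refl = ∼-refl

⟨nested⟩∷nested∼nested : ∀ p q → ⟨ nested p ⟩ ∷ nested q ∼ nested (q + suc p)
⟨nested⟩∷nested∼nested p zero    = ∼-refl
⟨nested⟩∷nested∼nested p (suc q) = ∼-trans (regroup q) (R1 (⟨nested⟩∷nested∼nested p q))
  where
  regroup : ∀ q → ⟨ nested p ⟩ ∷ nested (suc q) ∼ enc (⟨ nested p ⟩ ∷ nested q)
  regroup zero    = R4 (just ⟨ nested p ⟩) nothing nothing
  regroup (suc q) = R4 (just ⟨ nested p ⟩) (just ⟨ nested q ⟩) nothing

UnaryBinary⇒∼nested : ∀ A → UnaryBinary A → A ∼ nested (size A)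
UnaryBinary⇒∼nested []              _ = ∼-refl
UnaryBinary⇒∼nested (⟨ X ⟩ ∷ [])    u =
  ∼-trans (R1 (UnaryBinary⇒∼nested X u)) (≡⇒∼ (cong nested (sym (size-enc X))))
UnaryBinary⇒∼nested (⟨ X ⟩ ∷ ⟨ Y ⟩ ∷ []) (u , v) =
  ∼-trans (R2 [] (⟨ Y ⟩ ∷ []) {just ⟨ X ⟩} {just ⟨ nested x ⟩} (R1 (UnaryBinary⇒∼nested X u)))
  (∼-trans (R2 (⟨ nested x ⟩ ∷ []) [] {just ⟨ Y ⟩} {just ⟨ nested y ⟩} (R1 (UnaryBinary⇒∼nested Y v)))
  (∼-trans (⟨nested⟩∷nested∼nested x (suc y))
  (≡⇒∼ (cong nested (trans (+-comm (suc y) (suc x)) (cong (suc x +_) (sym (+-identityʳ (suc y)))))))))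
  where
  x y : ℕ
  x = size X
  y = size Y

mainCohort⇔ : ∀ n A → InMainCohort n A ⇔ (UnaryBinary A × size A ≡ n)
mainCohort⇔ n A = mk⇔
  (λ h → Equivalence.from (∼⇒UnaryBinary⇔ h) (UnaryBinary-nested n) , trans (∼⇒size≡ h) (size-nested n))
  (λ { (u , refl) → UnaryBinary⇒∼nested A u })

-- Binomial coefficients and ballot numbers

[m+n]Cm≡[m+n]Cn : ∀ m n → (m + n) C m ≡ (m + n) C n
[m+n]Cm≡[m+n]Cn m n = trans (nCk≡nC[n∸k] (m≤m+n m n)) (cong ((m + n) C_) (m+n∸m≡n m n))

[k+1]*[n+1]C[k+1]≡[n+1]*nCk : ∀ n k → suc k * (suc n C suc k) ≡ suc n * (n C k)
[k+1]*[n+1]C[k+1]≡[n+1]*nCk zero    zero    = refl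
[k+1]*[n+1]C[k+1]≡[n+1]*nCk zero    (suc k) = *-zeroʳ (suc (suc k))
[k+1]*[n+1]C[k+1]≡[n+1]*nCk (suc n) zero    =
  trans (+-identityʳ _) (trans (nC1≡n (suc (suc n))) (sym (*-identityʳ (suc (suc n)))))
[k+1]*[n+1]C[k+1]≡[n+1]*nCk (suc n) (suc k) = begin
  suc (suc k) * (suc (suc n) C suc (suc k)) ≡⟨ cong (suc (suc k) *_) (pascal (suc n) (suc k)) ⟨
  suc (suc k) * (X + Y)                     ≡⟨ spread k X Y ⟩
  X + (suc k * X + suc (suc k) * Y)         ≡⟨ cong₂ (λ u v → X + (u + v)) ([k+1]*[n+1]C[k+1]≡[n+1]*nCk n k)
                                                                          ([k+1]*[n+1]C[k+1]≡[n+1]*nCk n (suc k)) ⟩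
  X + (suc n * (n C k) + suc n * (n C suc k)) ≡⟨ cong (X +_) (*-distribˡ-+ (suc n) (n C k) _) ⟨
  X + suc n * (n C k + n C suc k)           ≡⟨ cong (λ z → X + suc n * z) (pascal n k) ⟩
  suc (suc n) * X                           ∎
  where
  open ≡-Reasoning
  pascal : ∀ n k → n C k + n C suc k ≡ suc n C suc k
  pascal = nCk+nC[k+1]≡[n+1]C[k+1]
  X Y : ℕ
  X = suc n C suc k
  Y = suc n C suc (suc k)
  spread : ∀ k X Y → suc (suc k) * (X + Y) ≡ X + (suc k * X + suc (suc k) * Y)
  spread = solve-∀

[d+1]*[k+d+1]Ck≡[k+1]*[k+d+1]C[k+1] : ∀ k d → suc d * (suc (k + d) C k) ≡ suc k * (suc (k + d) C suc k)
[d+1]*[k+d+1]Ck≡[k+1]*[k+d+1]C[k+1] k d = begin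
  suc d * (suc (k + d) C k)     ≡⟨ cong (suc d *_) outer-symmetry ⟩
  suc d * (suc (k + d) C suc d) ≡⟨ [k+1]*[n+1]C[k+1]≡[n+1]*nCk (k + d) d ⟩
  suc (k + d) * ((k + d) C d)   ≡⟨ cong (suc (k + d) *_) ([m+n]Cm≡[m+n]Cn k d) ⟨
  suc (k + d) * ((k + d) C k)   ≡⟨ [k+1]*[n+1]C[k+1]≡[n+1]*nCk (k + d) k ⟨
  suc k * (suc (k + d) C suc k) ∎
  where
  open ≡-Reasoning
  outer-symmetry : suc (k + d) C k ≡ suc (k + d) C suc d
  outer-symmetry = subst (λ m → m C k ≡ m C suc d) (+-suc k d) ([m+n]Cm≡[m+n]Cn k (suc d))

-- m C⁻ k is m C (k − 1), with m C⁻ 0 = 0 (rather than the truncated m C (0 ∸ 1) = 1).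
infixl 6.5 _C⁻_
_C⁻_ : ℕ → ℕ → ℕ
m C⁻ zero  = 0
m C⁻ suc k = m C k

[m+1]Ck≡mC⁻k+mCk : ∀ m k → suc m C k ≡ m C⁻ k + m C k
[m+1]Ck≡mC⁻k+mCk m zero    = refl
[m+1]Ck≡mC⁻k+mCk m (suc k) = sym (nCk+nC[k+1]≡[n+1]C[k+1] m k)

j+2[1+b]≡2+[j+2b] : ∀ j b → j + 2 * suc b ≡ suc (suc (j + 2 * b))
j+2[1+b]≡2+[j+2b] j b = trans (cong (j +_) (*-suc 2 b)) (trans (+-suc j _) (cong suc (+-suc j _)))

-- ballot b j counts the words of b joins and b + j pushes, ending at height j, in which
-- every join has two entries to act on; the recursion is on the last letter.
ballot : ℕ → ℕ → ℕ
ballot zero    j       = 1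
ballot (suc b) zero    = ballot b 1
ballot (suc b) (suc j) = ballot b (suc (suc j)) + ballot (suc b) j

ballot-reflection : ∀ b j → ballot b j + (j + 2 * b) C⁻ b ≡ (j + 2 * b) C b
ballot-reflection zero    j       = refl
ballot-reflection (suc b) zero    = begin
  ballot b 1 + (2 * suc b) C b             ≡⟨ cong (λ m → ballot b 1 + m C b) 2[1+b] ⟩
  ballot b 1 + suc (suc M) C b             ≡⟨ cong (ballot b 1 +_) ([m+1]Ck≡mC⁻k+mCk (suc M) b) ⟩
  ballot b 1 + (suc M C⁻ b + suc M C b)    ≡⟨ +-assoc (ballot b 1) _ _ ⟨
  ballot b 1 + suc M C⁻ b + suc M C b      ≡⟨ cong (_+ suc M C b) (ballot-reflection b 1) ⟩
  suc M C b + suc M C b                    ≡⟨ cong (suc M C b +_) middle-symmetry ⟩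
  suc M C b + suc M C suc b                ≡⟨ nCk+nC[k+1]≡[n+1]C[k+1] (suc M) b ⟩
  suc (suc M) C suc b                      ≡⟨ cong (_C suc b) 2[1+b] ⟨
  (2 * suc b) C suc b                      ∎
  where
  open ≡-Reasoning
  M : ℕ
  M = 2 * b
  2[1+b] : 2 * suc b ≡ suc (suc M)
  2[1+b] = j+2[1+b]≡2+[j+2b] 0 b
  middle-symmetry : suc M C b ≡ suc M C suc b
  middle-symmetry = subst (λ m → m C b ≡ m C suc b) b+[1+b]≡1+2b ([m+n]Cm≡[m+n]Cn b (suc b))
    where
    b+[1+b]≡1+2b : b + suc b ≡ suc M
    b+[1+b]≡1+2b = trans (+-suc b b) (cong (λ z → suc (b + z)) (sym (+-identityʳ b)))
ballot-reflection (suc b) (suc j) = begin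
  (E₁ + E₂) + suc K C b             ≡⟨ cong ((E₁ + E₂) +_) ([m+1]Ck≡mC⁻k+mCk K b) ⟩
  (E₁ + E₂) + (K C⁻ b + K C b)      ≡⟨ interchange E₁ E₂ _ _ ⟩
  (E₁ + K C⁻ b) + (E₂ + K C b)      ≡⟨ cong₂ _+_ reflection₁ (ballot-reflection (suc b) j) ⟩
  K C b + K C suc b                 ≡⟨ nCk+nC[k+1]≡[n+1]C[k+1] K b ⟩
  suc K C suc b                     ∎
  where
  open ≡-Reasoning
  E₁ E₂ K : ℕ
  E₁ = ballot b (suc (suc j))
  E₂ = ballot (suc b) j
  K  = j + 2 * suc b
  reflection₁ : E₁ + K C⁻ b ≡ K C b
  reflection₁ = subst (λ m → E₁ + m C⁻ b ≡ m C b) (sym (j+2[1+b]≡2+[j+2b] j b))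
                      (ballot-reflection b (suc (suc j)))

[k+1]*ballot[k,0]≡[2k]Ck : ∀ k → suc k * ballot k 0 ≡ (2 * k) C k
[k+1]*ballot[k,0]≡[2k]Ck zero    = refl
[k+1]*ballot[k,0]≡[2k]Ck (suc s) = +-cancelʳ-≡ (suc (suc s) * (M C s)) _ _ (begin
  suc (suc s) * E + suc (suc s) * (M C s) ≡⟨ *-distribˡ-+ (suc (suc s)) E _ ⟨
  suc (suc s) * (E + M C s)               ≡⟨ cong (suc (suc s) *_) (ballot-reflection (suc s) 0) ⟩
  M C suc s + suc s * (M C suc s)         ≡⟨ cong (M C suc s +_) ratio ⟨
  M C suc s + suc (suc s) * (M C s)       ∎)
  where
  open ≡-Reasoning
  E M : ℕ
  E = ballot (suc s) 0
  M = 2 * suc s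
  M≡1+s+[1+s] : suc (s + suc s) ≡ M
  M≡1+s+[1+s] = cong (λ z → suc (s + suc z)) (sym (+-identityʳ s))
  ratio : suc (suc s) * (M C s) ≡ suc s * (M C suc s)
  ratio = subst (λ m → suc (suc s) * (m C s) ≡ suc s * (m C suc s)) M≡1+s+[1+s]
                ([d+1]*[k+d+1]Ck≡[k+1]*[k+d+1]C[k+1] s (suc s))

catalan≡ballot : ∀ k → catalan k ≡ ballot k 0
catalan≡ballot k = begin
  ((2 * k) C k) / suc k        ≡⟨ cong (_/ suc k) ([k+1]*ballot[k,0]≡[2k]Ck k) ⟨
  (suc k * ballot k 0) / suc k ≡⟨ cong (_/ suc k) (*-comm (suc k) (ballot k 0)) ⟩
  (ballot k 0 * suc k) / suc k ≡⟨ m*n/n≡m (ballot k 0) (suc k) ⟩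
  ballot k 0                   ∎
  where open ≡-Reasoning

-- Spelling unary-binary systems

Stack : ℕ → Set
Stack j = Vec ArchSystem (suc j)

wrap : ∀ {j} → Stack j → Stack j
wrap (X ∷ Xs) = enc X ∷ Xs

join : ∀ {j} → Stack (suc j) → Stack j
join (X ∷ Y ∷ Xs) = (⟨ X ⟩ ∷ ⟨ Y ⟩ ∷ []) ∷ Xs

push : ∀ {j} → Stack j → Stack (suc j)
push Xs = [] ∷ Xs

pending : ∀ {j} → Vec ArchSystem j → ℕ
pending []       = 0
pending (X ∷ Xs) = suc (size X + pending Xs)

-- the number of letters spelling a stack: one per arch, plus one per push not yet
-- consumed by a join, i.e. per entry below the top
weight : ∀ {j} → Stack j → ℕ
weight (X ∷ Xs) = size X + pending Xs

mutual
  branchingsAtom : Atom → ℕ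
  branchingsAtom ⟨ X ⟩ = branchings X

  branchings : ArchSystem → ℕ
  branchings []          = 0
  branchings (a ∷ [])    = branchingsAtom a
  branchings (a ∷ b ∷ _) = suc (branchingsAtom a + branchingsAtom b)

totalBranchings : ∀ {j} → Vec ArchSystem j → ℕ
totalBranchings []       = 0
totalBranchings (X ∷ Xs) = branchings X + totalBranchings Xs

StackSpec : ℕ → ℕ → ∀ {j} → Stack j → Set
StackSpec n b St = Allᵛ UnaryBinary St × weight St ≡ n × totalBranchings St ≡ b

weight-wrap : ∀ {j} (St : Stack j) → weight (wrap St) ≡ suc (weight St)
weight-wrap (X ∷ Xs) = cong (_+ pending Xs) (size-enc X)

weight-join : ∀ {j} (St : Stack (suc j)) → weight (join St) ≡ suc (weight St)
weight-join (X ∷ Y ∷ Xs) = shuffle (size X) (size Y) (pending Xs)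
  where
  shuffle : ∀ x y p → suc x + (suc y + 0) + p ≡ suc (x + suc (y + p))
  shuffle = solve-∀

totalBranchings-join : ∀ {j} (St : Stack (suc j)) → totalBranchings (join St) ≡ suc (totalBranchings St)
totalBranchings-join (X ∷ Y ∷ Xs) = cong suc (+-assoc (branchings X) (branchings Y) (totalBranchings Xs))

wrap-spec : ∀ {n b j} {St : Stack j} → StackSpec n b St → StackSpec (suc n) b (wrap St)
wrap-spec {St = St@(_ ∷ _)} (u ∷ us , w , e) = u ∷ us , trans (weight-wrap St) (cong suc w) , e

join-spec : ∀ {n b j} {St : Stack (suc j)} → StackSpec n b St → StackSpec (suc n) (suc b) (join St)
join-spec {St = St@(_ ∷ _ ∷ _)} (u ∷ v ∷ us , w , e) =
  (u , v) ∷ us , trans (weight-join St) (cong suc w) , trans (totalBranchings-join St) (cong suc e)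

push-spec : ∀ {n b j} {St : Stack j} → StackSpec n b St → StackSpec (suc n) b (push St)
push-spec {St = _ ∷ _} (us , w , e) = tt ∷ us , cong suc w , e

mutual
  stacks : ℕ → ℕ → (j : ℕ) → List (Stack j)
  stacks zero    zero    zero    = ([] ∷ []) ∷ []
  stacks zero    (suc b) j       = []
  stacks zero    zero    (suc j) = []
  stacks (suc n) b       j       = joined n b j ++ pushed n b j ++ map wrap (stacks n b j)

  joined : ℕ → ℕ → (j : ℕ) → List (Stack j)
  joined n zero    j = []
  joined n (suc b) j = map join (stacks n b (suc j))

  pushed : ℕ → ℕ → (j : ℕ) → List (Stack j)
  pushed n b zero    = []
  pushed n b (suc j) = map push (stacks n b j)

mutual
  stacks-sound : ∀ n b j → All (StackSpec n b) (stacks n b j)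
  stacks-sound zero    zero    zero    = ((tt ∷ []) , refl , refl) ∷ []
  stacks-sound zero    (suc b) j       = []
  stacks-sound zero    zero    (suc j) = []
  stacks-sound (suc n) b       j       =
    AllP.++⁺ (joined-sound n b j) (AllP.++⁺ (pushed-sound n b j) (AllP.map⁺ (All.map wrap-spec (stacks-sound n b j))))

  joined-sound : ∀ n b j → All (StackSpec (suc n) b) (joined n b j)
  joined-sound n zero    j = []
  joined-sound n (suc b) j = AllP.map⁺ (All.map join-spec (stacks-sound n b (suc j)))

  pushed-sound : ∀ n b j → All (StackSpec (suc n) b) (pushed n b j)
  pushed-sound n b zero    = []
  pushed-sound n b (suc j) = AllP.map⁺ (All.map push-spec (stacks-sound n b j))

stacks-complete : ∀ n b j (St : Stack j) → StackSpec n b St → St ∈ stacks n b j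
stacks-complete zero    _ zero    ([] ∷ [])            (_ , refl , refl) = here refl
stacks-complete zero    _ (suc j) ([] ∷ _ ∷ _)         (_ , () , _)
stacks-complete zero    _ _       ((⟨ _ ⟩ ∷ _) ∷ _)    (_ , () , _)
stacks-complete (suc n) _ zero    ([] ∷ [])            (_ , () , _)
stacks-complete (suc n) b (suc j) ([] ∷ St@(_ ∷ _))    (_ ∷ us , w , e) =
  ∈-++⁺ʳ (joined n b (suc j)) (∈-++⁺ˡ (∈-map⁺ push (stacks-complete n b j St (us , suc-injective w , e))))
stacks-complete (suc n) b j       ((⟨ X ⟩ ∷ []) ∷ Xs)  (u ∷ us , w , e) =
  ∈-++⁺ʳ (joined n b j) (∈-++⁺ʳ (pushed n b j) (∈-map⁺ wrap
    (stacks-complete n b j (X ∷ Xs) (u ∷ us , suc-injective (trans (sym (weight-wrap (X ∷ Xs))) w) , e))))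
stacks-complete (suc n) _ j       ((⟨ X ⟩ ∷ ⟨ Y ⟩ ∷ []) ∷ Xs) ((u , v) ∷ us , w , refl) =
  ∈-++⁺ˡ (∈-map⁺ join (stacks-complete n _ (suc j) St
    (u ∷ v ∷ us , suc-injective (trans (sym (weight-join St)) w) , suc-injective (sym (totalBranchings-join St)))))
  where
  St : Stack (suc j)
  St = X ∷ Y ∷ Xs
stacks-complete (suc n) _ _       ((_ ∷ _ ∷ _ ∷ _) ∷ _) (() ∷ _ , _)

topLength : ∀ {j} → Stack j → ℕ
topLength St = length (head St)

topLength-map : ∀ {i j k} {f : Stack i → Stack j} {Sts St} →
                (∀ St → topLength (f St) ≡ k) → St ∈ map f Sts → topLength St ≡ k
topLength-map {f = f} f-top St∈ with ∈-map⁻ f St∈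
... | St , _ , refl = f-top St

topLength-joined : ∀ {n b j St} → St ∈ joined n b j → topLength St ≡ 2
topLength-joined {b = suc b} = topLength-map λ { (_ ∷ _ ∷ _) → refl }

topLength-pushed : ∀ {n b j St} → St ∈ pushed n b j → topLength St ≡ 0
topLength-pushed {j = suc j} = topLength-map λ _ → refl

topLength-wrapped : ∀ {j} {Sts : List (Stack j)} {St} → St ∈ map wrap Sts → topLength St ≡ 1
topLength-wrapped = topLength-map λ { (_ ∷ _) → refl }

wrap-injective : ∀ {j} {St St′ : Stack j} → wrap St ≡ wrap St′ → St ≡ St′
wrap-injective {St = _ ∷ _} {_ ∷ _} refl = refl

join-injective : ∀ {j} {St St′ : Stack (suc j)} → join St ≡ join St′ → St ≡ St′
join-injective {St = _ ∷ _ ∷ _} {_ ∷ _ ∷ _} refl = refl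

push-injective : ∀ {j} {St St′ : Stack j} → push St ≡ push St′ → St ≡ St′
push-injective refl = refl

mutual
  stacks-unique : ∀ n b j → Unique (stacks n b j)
  stacks-unique zero    zero    zero    = [] ∷ []
  stacks-unique zero    (suc b) j       = []
  stacks-unique zero    zero    (suc j) = []
  stacks-unique (suc n) b       j       =
    Unique.++⁺ (joined-unique n b j)
      (Unique.++⁺ (pushed-unique n b j) (Unique.map⁺ wrap-injective (stacks-unique n b j))
        λ (p , w) → 0≢1+n (trans (sym (topLength-pushed {n} {b} p)) (topLength-wrapped w)))
      λ (jn , pw) → case ∈-++⁻ (pushed n b j) pw of λ where
        (inj₁ p) → 0≢1+n (trans (sym (topLength-pushed {n} {b} p)) (topLength-joined {n} {b} jn))
        (inj₂ w) → 1≢2 (trans (sym (topLength-wrapped w)) (topLength-joined {n} {b} jn))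
    where
    1≢2 : 1 ≢ 2
    1≢2 ()

  joined-unique : ∀ n b j → Unique (joined n b j)
  joined-unique n zero    j = []
  joined-unique n (suc b) j = Unique.map⁺ join-injective (stacks-unique n b (suc j))

  pushed-unique : ∀ n b j → Unique (pushed n b j)
  pushed-unique n b zero    = []
  pushed-unique n b (suc j) = Unique.map⁺ push-injective (stacks-unique n b j)

-- Counting

length-stacks-suc : ∀ n b j →
  length (stacks (suc n) b j) ≡ length (joined n b j) + (length (pushed n b j) + length (stacks n b j))
length-stacks-suc n b j =
  trans (length-++ (joined n b j)) (cong (length (joined n b j) +_)
    (trans (length-++ (pushed n b j)) (cong (length (pushed n b j) +_) (length-map wrap (stacks n b j)))))

pascal-* : ∀ n k e → (n C k) * e + (n C suc k) * e ≡ (suc n C suc k) * e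
pascal-* n k e = trans (sym (*-distribʳ-+ e (n C k) (n C suc k))) (cong (_* e) (nCk+nC[k+1]≡[n+1]C[k+1] n k))

length-stacks : ∀ n b j → length (stacks n b j) ≡ (n C (j + 2 * b)) * ballot b j
length-stacks zero    zero    zero    = refl
length-stacks zero    (suc b) j       =
  sym (cong (_* ballot (suc b) j) (k>n⇒nCk≡0 (≤-trans (s≤s z≤n) (m≤n+m (2 * suc b) j))))
length-stacks zero    zero    (suc j) = refl
length-stacks (suc n) zero    zero    = trans (length-stacks-suc n 0 0) (length-stacks n 0 0)
length-stacks (suc n) zero    (suc j) = begin
  length (stacks (suc n) 0 (suc j))
    ≡⟨ length-stacks-suc n 0 (suc j) ⟩
  length (map push (stacks n 0 j)) + length (stacks n 0 (suc j))
    ≡⟨ cong₂ _+_ (trans (length-map push (stacks n 0 j)) (length-stacks n 0 j)) (length-stacks n 0 (suc j)) ⟩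
  (n C (j + 0)) * 1 + (n C suc (j + 0)) * 1
    ≡⟨ pascal-* n (j + 0) 1 ⟩
  (suc n C suc (j + 0)) * 1 ∎
  where open ≡-Reasoning
length-stacks (suc n) (suc b) zero    = begin
  length (stacks (suc n) (suc b) 0)
    ≡⟨ length-stacks-suc n (suc b) 0 ⟩
  length (map join (stacks n b 1)) + length (stacks n (suc b) 0)
    ≡⟨ cong₂ _+_ (trans (length-map join (stacks n b 1)) (length-stacks n b 1)) (length-stacks n (suc b) 0) ⟩
  (n C suc (2 * b)) * E + (n C (2 * suc b)) * E
    ≡⟨ cong (λ m → (n C suc (2 * b)) * E + (n C m) * E) 2[1+b] ⟩
  (n C suc (2 * b)) * E + (n C suc (suc (2 * b))) * E
    ≡⟨ pascal-* n (suc (2 * b)) E ⟩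
  (suc n C suc (suc (2 * b))) * E
    ≡⟨ cong (λ m → (suc n C m) * E) 2[1+b] ⟨
  (suc n C (2 * suc b)) * E ∎
  where
  open ≡-Reasoning
  E : ℕ
  E = ballot b 1
  2[1+b] : 2 * suc b ≡ suc (suc (2 * b))
  2[1+b] = j+2[1+b]≡2+[j+2b] 0 b
length-stacks (suc n) (suc b) (suc j) = begin
  length (stacks (suc n) (suc b) (suc j))
    ≡⟨ length-stacks-suc n (suc b) (suc j) ⟩
  length (map join (stacks n b (suc (suc j)))) + (length (map push (stacks n (suc b) j)) + length (stacks n (suc b) (suc j)))
    ≡⟨ cong₂ _+_ (trans (length-map join (stacks n b (suc (suc j)))) (length-stacks n b (suc (suc j))))
                 (cong₂ _+_ (trans (length-map push (stacks n (suc b) j)) (length-stacks n (suc b) j))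
                            (length-stacks n (suc b) (suc j))) ⟩
  (n C suc (suc (j + 2 * b))) * E₁ + ((n C K) * E₂ + (n C suc K) * (E₁ + E₂))
    ≡⟨ cong (λ m → (n C m) * E₁ + ((n C K) * E₂ + (n C suc K) * (E₁ + E₂))) (j+2[1+b]≡2+[j+2b] j b) ⟨
  (n C K) * E₁ + ((n C K) * E₂ + (n C suc K) * (E₁ + E₂))
    ≡⟨ +-assoc ((n C K) * E₁) _ _ ⟨
  ((n C K) * E₁ + (n C K) * E₂) + (n C suc K) * (E₁ + E₂)
    ≡⟨ cong (_+ (n C suc K) * (E₁ + E₂)) (*-distribˡ-+ (n C K) E₁ E₂) ⟨
  (n C K) * (E₁ + E₂) + (n C suc K) * (E₁ + E₂)
    ≡⟨ pascal-* n K (E₁ + E₂) ⟩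
  (suc n C suc K) * (E₁ + E₂) ∎
  where
  open ≡-Reasoning
  E₁ E₂ K : ℕ
  E₁ = ballot b (suc (suc j))
  E₂ = ballot (suc b) j
  K  = j + 2 * suc b

ofBranchings : ℕ → ℕ → List ArchSystem
ofBranchings n k = map head (stacks n k 0)

∈-ofBranchings : ∀ n k A → A ∈ ofBranchings n k ⇔ (UnaryBinary A × size A ≡ n × branchings A ≡ k)
∈-ofBranchings n k A = mk⇔ to from
  where
  to : A ∈ ofBranchings n k → UnaryBinary A × size A ≡ n × branchings A ≡ k
  to A∈ with ∈-map⁻ head A∈
  ... | X ∷ [] , St∈ , refl with All.lookup (stacks-sound n k 0) St∈
  ...   | u ∷ [] , w , e = u , trans (sym (+-identityʳ (size X))) w , trans (sym (+-identityʳ (branchings X))) e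
  from : UnaryBinary A × size A ≡ n × branchings A ≡ k → A ∈ ofBranchings n k
  from (u , s , e) = ∈-map⁺ head
    (stacks-complete n k 0 (A ∷ []) (u ∷ [] , trans (+-identityʳ (size A)) s , trans (+-identityʳ (branchings A)) e))

length-ofBranchings : ∀ n k → length (ofBranchings n k) ≡ (n C (2 * k)) * catalan k
length-ofBranchings n k =
  trans (length-map head (stacks n k 0)) (trans (length-stacks n k 0) (cong ((n C (2 * k)) *_) (sym (catalan≡ballot k))))

2*branchings≤size : ∀ A → UnaryBinary A → 2 * branchings A ≤ size A
2*branchings≤size []                    _       = z≤n
2*branchings≤size (⟨ X ⟩ ∷ [])          u       =
  ≤-trans (2*branchings≤size X u) (≤-trans (n≤1+n (size X)) (≤-reflexive (sym (size-enc X))))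
2*branchings≤size (⟨ X ⟩ ∷ ⟨ Y ⟩ ∷ [])  (u , v) = begin
  2 * suc (branchings X + branchings Y)
    ≡⟨ spread (branchings X) (branchings Y) ⟩
  suc (suc (2 * branchings X + 2 * branchings Y))
    ≤⟨ s≤s (s≤s (+-mono-≤ (2*branchings≤size X u) (2*branchings≤size Y v))) ⟩
  suc (suc (size X + size Y))
    ≡⟨ collect (size X) (size Y) ⟩
  suc (size X) + (suc (size Y) + 0) ∎
  where
  open ≤-Reasoning
  spread : ∀ x y → 2 * suc (x + y) ≡ suc (suc (2 * x + 2 * y))
  spread = solve-∀
  collect : ∀ x y → suc (suc (x + y)) ≡ suc x + (suc y + 0)
  collect = solve-∀

branchings≤size/2 : ∀ A → UnaryBinary A → branchings A ≤ size A / 2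
branchings≤size/2 A u = begin
  branchings A         ≡⟨ m*n/n≡m (branchings A) 2 ⟨
  branchings A * 2 / 2 ≤⟨ /-monoˡ-≤ 2 (≤-trans (≤-reflexive (*-comm (branchings A) 2)) (2*branchings≤size A u)) ⟩
  size A / 2           ∎
  where open ≤-Reasoning

length-concatMap : ∀ {A B : Set} (f : A → List B) xs →
                   length (concatMap f xs) ≡ sum (map (λ x → length (f x)) xs)
length-concatMap f []       = refl
length-concatMap f (x ∷ xs) = trans (length-++ (f x)) (cong (length (f x) +_) (length-concatMap f xs))

unaryBinary : ℕ → List ArchSystem
unaryBinary n = concatMap (ofBranchings n) (upTo (suc (n / 2)))

∈-unaryBinary : ∀ n A → A ∈ unaryBinary n ⇔ (UnaryBinary A × size A ≡ n)
∈-unaryBinary n A = mk⇔ to from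
  where
  to : A ∈ unaryBinary n → UnaryBinary A × size A ≡ n
  to A∈ with ∈-concat⁻′ (map (ofBranchings n) (upTo (suc (n / 2)))) A∈
  ... | As , A∈As , As∈ with ∈-map⁻ (ofBranchings n) As∈
  ...   | k , _ , refl = let u , s , _ = Equivalence.to (∈-ofBranchings n k A) A∈As in u , s
  from : UnaryBinary A × size A ≡ n → A ∈ unaryBinary n
  from (u , refl) = ∈-concat⁺′ (Equivalence.from (∈-ofBranchings n (branchings A) A) (u , refl , refl))
    (∈-map⁺ (ofBranchings n) (∈-upTo⁺ (s≤s (branchings≤size/2 A u))))

unaryBinary-unique : ∀ n → Unique (unaryBinary n)
unaryBinary-unique n = Unique.concat⁺
  (AllP.map⁺ (All.universal (λ k → Unique.map⁺ head-injective (stacks-unique n k 0)) (upTo (suc (n / 2)))))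
  (AllPairsP.map⁺ (AllPairs.map disjoint (Unique.upTo⁺ (suc (n / 2)))))
  where
  head-injective : ∀ {St St′ : Stack 0} → head St ≡ head St′ → St ≡ St′
  head-injective {_ ∷ []} {_ ∷ []} refl = refl
  branchings-of : ∀ {k A} → A ∈ ofBranchings n k → branchings A ≡ k
  branchings-of {k} {A} A∈ = proj₂ (proj₂ (Equivalence.to (∈-ofBranchings n k A) A∈))
  disjoint : ∀ {k l} → k ≢ l → Disjoint (ofBranchings n k) (ofBranchings n l)
  disjoint k≢l (A∈k , A∈l) = k≢l (trans (sym (branchings-of A∈k)) (branchings-of A∈l))

length-unaryBinary : ∀ n → length (unaryBinary n) ≡ motzkin n
length-unaryBinary n =
  trans (length-concatMap (ofBranchings n) (upTo (suc (n / 2))))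
        (cong sum (map-cong (length-ofBranchings n) (upTo (suc (n / 2)))))

mainTheorem6 : ∀ (n : ℕ) → 1 ≤ n → HasCardinality (InMainCohort n) (motzkin n)
mainTheorem6 n _ =
  unaryBinary n ,
  unaryBinary-unique n ,
  (λ A → ⇔.trans (∈-unaryBinary n A) (⇔.sym (mainCohort⇔ n A))) ,
  length-unaryBinary n
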